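{- Let $m,n\ge 0$ and let $\lambda:\{0,1,2,3\}^m\times\{0,1\}^n\to\{0,1\}$ be any function. Then the set $$M_\lambda=\Big\{(x'_1x''_1,\dots,x'_{m+n}x''_{m+n})\in D(m,n)\ \Big|\ \sum_{i=1}^{m+n}x'_i\equiv 0 \pmod 2,\ \ \sum_{i=1}^{m+n}x''_i\equiv\lambda(x'_1,\dots,x'_{m+n})\pmod 2\Big\}$$ is an MDS code (maximum independent set) in $D(m,n)$.
   Context: The Shrikhande graph $\mathrm{Sh}$ has as vertices the pairs $ab=(a,b)$ with $a,b\in\{0,1,2,3\}=\mathbb{Z}_4$, where $u\sim v$ iff $u-v\in\{\pm(1,0),\pm(0,1),\pm(1,1)\}$ (mod 4). The complete graph $K_4$ has as vertices the pairs $ab$ with $a,b\in\{0,1\}$. $D(m,n)$ is the Cartesian product of $m$ copies of $\mathrm{Sh}$ (the first $m$ coordinates) and $n$ copies of $K_4$ (the last $n$ coordinates); a vertex is written $(x'_1x''_1,\dots,x'_{m+n}x''_{m+n})$, where $x'_ix''_i$ denotes the pair $(x'_i,x''_i)$. An MDS code in $D(m,n)$ is an independent set of size $4^{2m+n-1}$, the independence number of $D(m,n)$. -}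

module Defs where

open import Data.Nat using (ℕ; zero; suc; _+_; _*_; _∸_; _^_; _%_; _≤_)
open import Data.Fin using (Fin; toℕ)
open import Data.Vec using (Vec; []; _∷_; map)
open import Data.Product using (Σ; _×_; _,_; proj₁; proj₂)
open import Data.Sum using (_⊎_)
open import Data.Empty using (⊥)
open import Relation.Nullary using (¬_)
open import Relation.Binary.PropositionalEquality using (_≡_; _≢_)
open import Function.Bundles using (_↔_)

Z4 : Set
Z4 = Fin 4

ShV : Set
ShV = Z4 × Z4

K4V : Set
K4V = Fin 2 × Fin 2

diff4 : Z4 → Z4 → ℕ
diff4 a b = (toℕ a + 4 ∸ toℕ b) % 4

ShAdj : ShV → ShV → Set
ShAdj (a , b) (c , d) =
    (diff4 a c ≡ 1 × diff4 b d ≡ 0) ⊎ (diff4 a c ≡ 3 × diff4 b d ≡ 0)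
  ⊎ (diff4 a c ≡ 0 × diff4 b d ≡ 1) ⊎ (diff4 a c ≡ 0 × diff4 b d ≡ 3)
  ⊎ (diff4 a c ≡ 1 × diff4 b d ≡ 1) ⊎ (diff4 a c ≡ 3 × diff4 b d ≡ 3)

K4Adj : K4V → K4V → Set
K4Adj u v = u ≢ v

ProdAdj : {A : Set} (R : A → A → Set) {k : ℕ} → Vec A k → Vec A k → Set
ProdAdj R [] [] = ⊥
ProdAdj R (x ∷ xs) (y ∷ ys) = (R x y × xs ≡ ys) ⊎ (x ≡ y × ProdAdj R xs ys)

-- D(m,n) = Sh^m □ K4^n : first m coordinates in Sh, last n in K4.
Vertex : ℕ → ℕ → Set
Vertex m n = Vec ShV m × Vec K4V n

DAdj : {m n : ℕ} → Vertex m n → Vertex m n → Set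
DAdj (s , k) (s' , k') = (ProdAdj ShAdj s s' × k ≡ k') ⊎ (s ≡ s' × ProdAdj K4Adj k k')

VSet : ℕ → ℕ → Set₁
VSet m n = Vertex m n → Set

IsIndependent : {m n : ℕ} → VSet m n → Set
IsIndependent {m} {n} C = (u v : Vertex m n) → C u → C v → ¬ DAdj u v

HasSize : {m n : ℕ} → VSet m n → ℕ → Set
HasSize {m} {n} C k = Σ (Vertex m n) C ↔ Fin k

IsMDS : (m n : ℕ) → VSet m n → Set
IsMDS m n C = IsIndependent C × HasSize C (4 ^ (2 * m + n ∸ 1))

sumℕ : {k : ℕ} → Vec ℕ k → ℕ
sumℕ [] = 0
sumℕ (x ∷ xs) = x + sumℕ xs

Mλ : (m n : ℕ) → (Vec Z4 m → Vec (Fin 2) n → Fin 2) → VSet m n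
Mλ m n lam (s , k) =
  ((sumℕ (map (λ p → toℕ (proj₁ p)) s) + sumℕ (map (λ p → toℕ (proj₁ p)) k)) % 2 ≡ 0)
  × ((sumℕ (map (λ p → toℕ (proj₂ p)) s) + sumℕ (map (λ p → toℕ (proj₂ p)) k)) % 2
       ≡ toℕ (lam (map proj₁ s) (map proj₁ k)))

-- Along an edge of D(m,n) either the parity of Σ x′ changes, or every x′ stays put (so λ does not
-- change) while the parity of Σ x″ changes; two codewords therefore are never adjacent.  For the count,
-- write Fin (2h) as Fin h × Fin 2 by quotient and remainder: given the rest of a codeword, the two parity
-- conditions fix the remainders of x′₁ and x″₁ and nothing else, so M_λ is in bijection with the vertices
-- whose first coordinate has lost these two bits.
module Submission where

open import Defs
open import Data.Nat using (ℕ; zero; suc; _+_; _*_; _∸_; _^_; _%_; _≤_; _≟_; NonZero)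
open import Data.Nat.Properties using (+-commutativeSemigroup; +-comm; +-assoc; *-comm; *-identityˡ; ≡-irrelevant; ^-*-assoc; ^-distribˡ-+-*)
open import Data.Nat.DivMod using (_mod_; %-distribˡ-+; m%n%n≡m%n; [m+kn]%n≡m%n; m%n<n; m<n⇒m%n≡m)
open import Data.Nat.Tactic.RingSolver using (solve-∀)
open import Data.Fin using (Fin; toℕ; combine; remQuot; quotient; remainder) renaming (_≟_ to _≟ᶠ_)
open import Data.Fin.Properties using (toℕ<n; toℕ-fromℕ<; toℕ-injective; toℕ-combine; remQuot-combine; combine-remQuot; *↔×; all?)
open import Data.Fin.Patterns using (0F)
open import Data.Vec using (Vec; []; _∷_; map)
open import Data.Vec.Recursive using (lift↔; Fin[m^n]↔Fin[m]^n)
open import Data.Vec.Recursive.Properties using (↔Vec)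
open import Data.Product using (Σ; _×_; _,_; proj₁; proj₂; uncurry)
import Data.Product as Prod
open import Data.Product.Algebra using (×-cong)
open import Algebra.Properties.CommutativeSemigroup +-commutativeSemigroup using (x∙yz≈y∙xz)
open import Data.Product.Function.Dependent.Propositional using (Σ-↔)
open import Data.Sum using (_⊎_; inj₁; inj₂)
import Data.Sum as Sum
open import Function using (_∘_)
open import Function.Bundles using (_↔_; mk↔ₛ′; Inverse)
open import Function.Properties.Inverse using (↔-refl; ↔-sym; ↔-trans)
open import Relation.Nullary using (yes; no)
open import Relation.Nullary.Decidable using (from-yes; ¬?; _→-dec_; _⊎-dec_)
open import Relation.Binary.PropositionalEquality

[m%n+o]%n≡[m+o]%n : ∀ m o n .{{_ : NonZero n}} → (m % n + o) % n ≡ (m + o) % n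
[m%n+o]%n≡[m+o]%n m o n = begin
  (m % n + o) % n          ≡⟨ %-distribˡ-+ (m % n) o n ⟩
  (m % n % n + o % n) % n  ≡⟨ cong (λ x → (x + o % n) % n) (m%n%n≡m%n m n) ⟩
  (m % n + o % n) % n      ≡⟨ %-distribˡ-+ m o n ⟨
  (m + o) % n              ∎
  where open ≡-Reasoning

[m+n+n]%2≡m%2 : ∀ m n → (m + n + n) % 2 ≡ m % 2
[m+n+n]%2≡m%2 m n = trans (cong (_% 2) (m+n+n≡m+n*2 m n)) ([m+kn]%n≡m%n m n 2)
  where
  m+n+n≡m+n*2 : ∀ m n → m + n + n ≡ m + n * 2
  m+n+n≡m+n*2 = solve-∀

m%2≡[n+o]%2⇒[m+o]%2≡n%2 : ∀ m n o → m % 2 ≡ (n + o) % 2 → (m + o) % 2 ≡ n % 2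
m%2≡[n+o]%2⇒[m+o]%2≡n%2 m n o eq = begin
  (m + o) % 2            ≡⟨ [m%n+o]%n≡[m+o]%n m o 2 ⟨
  (m % 2 + o) % 2        ≡⟨ cong (λ x → (x + o) % 2) eq ⟩
  ((n + o) % 2 + o) % 2  ≡⟨ [m%n+o]%n≡[m+o]%n (n + o) o 2 ⟩
  (n + o + o) % 2        ≡⟨ [m+n+n]%2≡m%2 n o ⟩
  n % 2                  ∎
  where open ≡-Reasoning

[m+o]%2≡n%2⇒m%2≡[n+o]%2 : ∀ m n o → (m + o) % 2 ≡ n % 2 → m % 2 ≡ (n + o) % 2
[m+o]%2≡n%2⇒m%2≡[n+o]%2 m n o eq = sym (m%2≡[n+o]%2⇒[m+o]%2≡n%2 n m o (sym eq))

[m+o]%2≡[n+o]%2⇒m%2≡n%2 : ∀ m n o → (m + o) % 2 ≡ (n + o) % 2 → m % 2 ≡ n % 2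
[m+o]%2≡[n+o]%2⇒m%2≡n%2 m n o eq = trans ([m+o]%2≡n%2⇒m%2≡[n+o]%2 m (n + o) o eq) ([m+n+n]%2≡m%2 n o)

%2-≢-+ʳ : ∀ m n o → m % 2 ≢ n % 2 → (m + o) % 2 ≢ (n + o) % 2
%2-≢-+ʳ m n o m≢n = m≢n ∘ [m+o]%2≡[n+o]%2⇒m%2≡n%2 m n o

%2-≢-+ˡ : ∀ m n o → m % 2 ≢ n % 2 → (o + m) % 2 ≢ (o + n) % 2
%2-≢-+ˡ m n o rewrite +-comm o m | +-comm o n = %2-≢-+ʳ m n o

toℕ%2≡toℕ : (c : Fin 2) → toℕ c % 2 ≡ toℕ c
toℕ%2≡toℕ c = m<n⇒m%n≡m (toℕ<n c)

≢⇒toℕ%2≢ : {c d : Fin 2} → c ≢ d → toℕ c % 2 ≢ toℕ d % 2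
≢⇒toℕ%2≢ {c} {d} c≢d eq = c≢d (toℕ-injective (trans (sym (toℕ%2≡toℕ c)) (trans eq (toℕ%2≡toℕ d))))

total : {A : Set} {k : ℕ} → (A → ℕ) → Vec A k → ℕ
total f xs = sumℕ (map f xs)

x′ x″ : {q : ℕ} → Fin q × Fin q → ℕ
x′ p = toℕ (proj₁ p)
x″ p = toℕ (proj₂ p)

Flips : {A K : Set} → (A → ℕ) → (A → ℕ) → (A → K) → A → A → Set
Flips f₁ f₂ key x y = f₁ x % 2 ≢ f₁ y % 2 ⊎ (key x ≡ key y × f₂ x % 2 ≢ f₂ y % 2)

diff4-odd⇒toℕ%2≢ : ∀ a c → diff4 a c ≡ 1 ⊎ diff4 a c ≡ 3 → toℕ a % 2 ≢ toℕ c % 2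
diff4-odd⇒toℕ%2≢ = from-yes (all? λ a → all? λ c →
  ((diff4 a c ≟ 1) ⊎-dec (diff4 a c ≟ 3)) →-dec ¬? (toℕ a % 2 ≟ toℕ c % 2))

diff4≡0⇒≡ : ∀ a c → diff4 a c ≡ 0 → a ≡ c
diff4≡0⇒≡ = from-yes (all? λ a → all? λ c → (diff4 a c ≟ 0) →-dec (a ≟ᶠ c))

ShAdj⇒Flips : ∀ u v → ShAdj u v → Flips x′ x″ proj₁ u v
ShAdj⇒Flips (a , b) (c , d) (inj₁ (a-c , _))                             = inj₁ (diff4-odd⇒toℕ%2≢ a c (inj₁ a-c))
ShAdj⇒Flips (a , b) (c , d) (inj₂ (inj₁ (a-c , _)))                      = inj₁ (diff4-odd⇒toℕ%2≢ a c (inj₂ a-c))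
ShAdj⇒Flips (a , b) (c , d) (inj₂ (inj₂ (inj₁ (a-c , b-d))))             = inj₂ (diff4≡0⇒≡ a c a-c , diff4-odd⇒toℕ%2≢ b d (inj₁ b-d))
ShAdj⇒Flips (a , b) (c , d) (inj₂ (inj₂ (inj₂ (inj₁ (a-c , b-d)))))      = inj₂ (diff4≡0⇒≡ a c a-c , diff4-odd⇒toℕ%2≢ b d (inj₂ b-d))
ShAdj⇒Flips (a , b) (c , d) (inj₂ (inj₂ (inj₂ (inj₂ (inj₁ (a-c , _)))))) = inj₁ (diff4-odd⇒toℕ%2≢ a c (inj₁ a-c))
ShAdj⇒Flips (a , b) (c , d) (inj₂ (inj₂ (inj₂ (inj₂ (inj₂ (a-c , _)))))) = inj₁ (diff4-odd⇒toℕ%2≢ a c (inj₂ a-c))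

K4Adj⇒Flips : ∀ u v → K4Adj u v → Flips x′ x″ proj₁ u v
K4Adj⇒Flips (a , b) (c , d) u≢v with a ≟ᶠ c
... | no a≢c   = inj₁ (≢⇒toℕ%2≢ a≢c)
... | yes refl = inj₂ (refl , ≢⇒toℕ%2≢ (u≢v ∘ cong (a ,_)))

module _ {A K : Set} {R : A → A → Set} {f₁ f₂ : A → ℕ} {key : A → K}
         (R⇒Flips : ∀ x y → R x y → Flips f₁ f₂ key x y) where

  ProdAdj⇒Flips : ∀ {k} (xs ys : Vec A k) → ProdAdj R xs ys → Flips (total f₁) (total f₂) (map key) xs ys
  ProdAdj⇒Flips [] [] ()
  ProdAdj⇒Flips (x ∷ xs) (y ∷ .xs) (inj₁ (x~y , refl)) =
    Sum.map (%2-≢-+ʳ (f₁ x) (f₁ y) (total f₁ xs))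
            (Prod.map (cong (_∷ map key xs)) (%2-≢-+ʳ (f₂ x) (f₂ y) (total f₂ xs)))
            (R⇒Flips x y x~y)
  ProdAdj⇒Flips (x ∷ xs) (.x ∷ ys) (inj₂ (refl , xs~ys)) =
    Sum.map (%2-≢-+ˡ (total f₁ xs) (total f₁ ys) (f₁ x))
            (Prod.map (cong (key x ∷_)) (%2-≢-+ˡ (total f₂ xs) (total f₂ ys) (f₂ x)))
            (ProdAdj⇒Flips xs ys xs~ys)

module _ {m n : ℕ} where

  X′ X″ : Vertex m n → ℕ
  X′ (s , k) = total x′ s + total x′ k
  X″ (s , k) = total x″ s + total x″ k

  key : Vertex m n → Vec Z4 m × Vec (Fin 2) n
  key (s , k) = map proj₁ s , map proj₁ k

  DAdj⇒Flips : ∀ u v → DAdj u v → Flips X′ X″ key u v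
  DAdj⇒Flips (s , k) (s′ , .k) (inj₁ (s~s′ , refl)) =
    Sum.map (%2-≢-+ʳ (total x′ s) (total x′ s′) (total x′ k))
            (Prod.map (cong (_, map proj₁ k)) (%2-≢-+ʳ (total x″ s) (total x″ s′) (total x″ k)))
            (ProdAdj⇒Flips ShAdj⇒Flips s s′ s~s′)
  DAdj⇒Flips (s , k) (.s , k′) (inj₂ (refl , k~k′)) =
    Sum.map (%2-≢-+ˡ (total x′ k) (total x′ k′) (total x′ s))
            (Prod.map (cong (map proj₁ s ,_)) (%2-≢-+ˡ (total x″ k) (total x″ k′) (total x″ s)))
            (ProdAdj⇒Flips K4Adj⇒Flips k k′ k~k′)

Mλ-independent : ∀ m n lam → IsIndependent (Mλ m n lam)
Mλ-independent m n lam u v (u′ , u″) (v′ , v″) u~v with DAdj⇒Flips u v u~v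
... | inj₁ X′≢        = X′≢ (trans u′ (sym v′))
... | inj₂ (≡key , X″≢) = X″≢ (trans u″ (trans (cong (toℕ ∘ uncurry lam) ≡key) (sym v″)))

toℕ-combine%2 : ∀ {h} (q : Fin h) (p : Fin 2) → toℕ (combine q p) % 2 ≡ toℕ p
toℕ-combine%2 q p = begin
  toℕ (combine q p) % 2      ≡⟨ cong (_% 2) (toℕ-combine q p) ⟩
  (2 * toℕ q + toℕ p) % 2    ≡⟨ cong (_% 2) (trans (+-comm (2 * toℕ q) (toℕ p)) (cong (toℕ p +_) (*-comm 2 (toℕ q)))) ⟩
  (toℕ p + toℕ q * 2) % 2    ≡⟨ [m+kn]%n≡m%n (toℕ p) (toℕ q) 2 ⟩
  toℕ p % 2                  ≡⟨ toℕ%2≡toℕ p ⟩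
  toℕ p                      ∎
  where open ≡-Reasoning

toℕ-mod : ∀ m n .{{_ : NonZero n}} → toℕ (m mod n) ≡ m % n
toℕ-mod m n = toℕ-fromℕ< (m%n<n m n)

solution : ∀ {h} → Fin h → ℕ → Fin 2 → Fin (h * 2)
solution q t c = combine q ((toℕ c + t) mod 2)

quotient-solution : ∀ {h} (q : Fin h) t c → quotient 2 (solution q t c) ≡ q
quotient-solution q t c = cong proj₁ (remQuot-combine q ((toℕ c + t) mod 2))

solution-solves : ∀ {h} (q : Fin h) t c → (toℕ (solution q t c) + t) % 2 ≡ toℕ c
solution-solves q t c = trans
  (m%2≡[n+o]%2⇒[m+o]%2≡n%2 (toℕ (solution q t c)) (toℕ c) t (trans (toℕ-combine%2 q _) (toℕ-mod (toℕ c + t) 2)))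
  (toℕ%2≡toℕ c)

solution-unique : ∀ {h} (a : Fin (h * 2)) t c → (toℕ a + t) % 2 ≡ toℕ c → solution {h} (quotient {h} 2 a) t c ≡ a
solution-unique {h} a t c a+t≡c = begin
  combine (quotient {h} 2 a) ((toℕ c + t) mod 2)  ≡⟨ cong (combine (quotient {h} 2 a)) remainder≡ ⟨
  combine (quotient {h} 2 a) (remainder {h} 2 a)  ≡⟨ combine-remQuot {h} 2 a ⟩
  a                                               ∎
  where
  open ≡-Reasoning
  remainder≡ : remainder {h} 2 a ≡ (toℕ c + t) mod 2
  remainder≡ = toℕ-injective (begin
    toℕ (remainder {h} 2 a)                      ≡⟨ toℕ-combine%2 (quotient {h} 2 a) (remainder {h} 2 a) ⟨
    toℕ (uncurry combine (remQuot {h} 2 a)) % 2  ≡⟨ cong (λ x → toℕ x % 2) (combine-remQuot {h} 2 a) ⟩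
    toℕ a % 2                                    ≡⟨ [m+o]%2≡n%2⇒m%2≡[n+o]%2 (toℕ a) (toℕ c) t
                                                      (trans a+t≡c (sym (toℕ%2≡toℕ c))) ⟩
    (toℕ c + t) % 2                              ≡⟨ toℕ-mod (toℕ c + t) 2 ⟨
    toℕ ((toℕ c + t) mod 2)                      ∎)

-- A codeword split into its first coordinate (a , b) and the rest r; for D(m,n) itself h is 2 when
-- m > 0 (first coordinate in Sh) and 1 when m = 0 (first coordinate in K4).
module ParityCode (h : ℕ) {R : Set} (t′ t″ : R → ℕ) (ℓ : Fin (h * 2) → R → Fin 2) where

  Conditions : (Fin (h * 2) × Fin (h * 2)) × R → Set
  Conditions ((a , b) , r) = (toℕ a + t′ r) % 2 ≡ 0 × (toℕ b + t″ r) % 2 ≡ toℕ (ℓ a r)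

  Code : Set
  Code = Σ ((Fin (h * 2) × Fin (h * 2)) × R) Conditions

  code↔ : Code ↔ ((Fin h × Fin h) × R)
  code↔ = mk↔ₛ′ to from to∘from from∘to
    where
    to : Code → (Fin h × Fin h) × R
    to (((a , b) , r) , _) = (quotient {h} 2 a , quotient {h} 2 b) , r

    from : (Fin h × Fin h) × R → Code
    from ((i , j) , r) = ((a , b) , r) , solution-solves i (t′ r) 0F , solution-solves j (t″ r) (ℓ a r)
      where
      a = solution i (t′ r) 0F
      b = solution j (t″ r) (ℓ a r)

    to∘from : ∀ x → to (from x) ≡ x
    to∘from ((i , j) , r) = cong₂ (λ i j → (i , j) , r)
      (quotient-solution i (t′ r) 0F) (quotient-solution j (t″ r) (ℓ (solution i (t′ r) 0F) r))

    code-≡ : ∀ {a₁ a₂ b₁ b₂ r} {p₁ q₁ p₂ q₂} → a₁ ≡ a₂ → b₁ ≡ b₂ →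
             _≡_ {A = Code} (((a₁ , b₁) , r) , p₁ , q₁) (((a₂ , b₂) , r) , p₂ , q₂)
    code-≡ {a₁} {b₁ = b₁} {r = r} refl refl =
      cong₂ (λ p q → ((a₁ , b₁) , r) , p , q) (≡-irrelevant _ _) (≡-irrelevant _ _)

    from∘to : ∀ x → from (to x) ≡ x
    from∘to (((a , b) , r) , p , q) = code-≡ a′≡a b′≡b
      where
      a′≡a = solution-unique {h} a (t′ r) 0F p
      b′≡b = trans (cong (λ a → solution {h} (quotient {h} 2 b) (t″ r) (ℓ a r)) a′≡a)
                   (solution-unique {h} b (t″ r) (ℓ a r) q)

%2≡-cong↔ : ∀ {m n} c → m ≡ n → (m % 2 ≡ c) ↔ (n % 2 ≡ c)
%2≡-cong↔ c refl = ↔-refl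

∷-↔ : {A C : Set} {k : ℕ} → (A × Vec A k × C) ↔ (Vec A (suc k) × C)
∷-↔ = mk↔ₛ′ (λ (x , xs , c) → x ∷ xs , c) (λ { (x ∷ xs , c) → x , xs , c }) (λ { (x ∷ xs , c) → refl }) (λ { (x , xs , c) → refl })

∷ʳ-↔ : {A C : Set} {k : ℕ} → (A × C × Vec A k) ↔ (C × Vec A (suc k))
∷ʳ-↔ = mk↔ₛ′ (λ (x , c , xs) → c , x ∷ xs) (λ { (c , x ∷ xs) → x , c , xs }) (λ { (c , x ∷ xs) → refl }) (λ { (x , c , xs) → refl })

module _ (m n : ℕ) (lam : Vec Z4 (suc m) → Vec (Fin 2) n → Fin 2) where
  open ParityCode 2 {Vertex m n} X′ X″ (λ a v → lam (a ∷ proj₁ (key v)) (proj₂ (key v)))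

  Mλ-suc↔ : Σ (Vertex (suc m) n) (Mλ (suc m) n lam) ↔ ((Fin 2 × Fin 2) × Vertex m n)
  Mλ-suc↔ = ↔-trans (↔-sym (Σ-↔ ∷-↔ (λ {x} → conditions↔ x))) code↔
    where
    conditions↔ : ∀ x → Conditions x ↔ Mλ (suc m) n lam (Inverse.to ∷-↔ x)
    conditions↔ ((a , b) , s , k) = ×-cong
      (%2≡-cong↔ 0 (sym (+-assoc (toℕ a) (total x′ s) (total x′ k))))
      (%2≡-cong↔ (toℕ (lam (a ∷ map proj₁ s) (map proj₁ k))) (sym (+-assoc (toℕ b) (total x″ s) (total x″ k))))

module _ (n : ℕ) (lam : Vec Z4 0 → Vec (Fin 2) (suc n) → Fin 2) where
  open ParityCode 1 {Vertex 0 n} X′ X″ (λ a v → lam (proj₁ (key v)) (a ∷ proj₂ (key v)))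

  Mλ-zero↔ : Σ (Vertex 0 (suc n)) (Mλ 0 (suc n) lam) ↔ ((Fin 1 × Fin 1) × Vertex 0 n)
  Mλ-zero↔ = ↔-trans (↔-sym (Σ-↔ ∷ʳ-↔ (λ {x} → conditions↔ x))) code↔
    where
    conditions↔ : ∀ x → Conditions x ↔ Mλ 0 (suc n) lam (Inverse.to ∷ʳ-↔ x)
    conditions↔ ((a , b) , s , k) = ×-cong
      (%2≡-cong↔ 0 (x∙yz≈y∙xz (toℕ a) (total x′ s) (total x′ k)))
      (%2≡-cong↔ (toℕ (lam (map proj₁ s) (a ∷ map proj₁ k))) (x∙yz≈y∙xz (toℕ b) (total x″ s) (total x″ k)))

×↔Fin : {A B : Set} {a b : ℕ} → A ↔ Fin a → B ↔ Fin b → (A × B) ↔ Fin (a * b)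
×↔Fin A↔a B↔b = ↔-trans (×-cong A↔a B↔b) (↔-sym *↔×)

Vec↔Fin : {A : Set} {a : ℕ} (k : ℕ) → A ↔ Fin a → Vec A k ↔ Fin (a ^ k)
Vec↔Fin {a = a} k A↔a = ↔-trans (↔-sym (↔Vec k)) (↔-trans (lift↔ k A↔a) (↔-sym (Fin[m^n]↔Fin[m]^n a k)))

Vertex↔Fin : ∀ m n → Vertex m n ↔ Fin (16 ^ m * 4 ^ n)
Vertex↔Fin m n = ×↔Fin (Vec↔Fin m (×↔Fin ↔-refl ↔-refl)) (Vec↔Fin n (×↔Fin ↔-refl ↔-refl))

Fin-cong : ∀ {a b} → a ≡ b → Fin a ↔ Fin b
Fin-cong refl = ↔-refl

4*[16^m*4^n]≡4^[2[1+m]+n∸1] : ∀ m n → 4 * (16 ^ m * 4 ^ n) ≡ 4 ^ (2 * suc m + n ∸ 1)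
4*[16^m*4^n]≡4^[2[1+m]+n∸1] m n = begin
  4 * (16 ^ m * 4 ^ n)       ≡⟨ cong (λ x → 4 * (x * 4 ^ n)) (^-*-assoc 4 2 m) ⟩
  4 * (4 ^ (2 * m) * 4 ^ n)  ≡⟨ cong (4 *_) (^-distribˡ-+-* 4 (2 * m) n) ⟨
  4 ^ suc (2 * m + n)        ≡⟨ cong (λ e → 4 ^ (e ∸ 1)) (exponent m n) ⟨
  4 ^ (2 * suc m + n ∸ 1)    ∎
  where
  open ≡-Reasoning
  exponent : ∀ m n → 2 * suc m + n ≡ 2 + (2 * m + n)
  exponent = solve-∀

Mλ-size : ∀ m n → 1 ≤ m + n → ∀ lam → HasSize (Mλ m n lam) (4 ^ (2 * m + n ∸ 1))
Mλ-size zero zero () lam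
Mλ-size zero (suc n) _ lam = ↔-trans (Mλ-zero↔ n lam) (↔-trans (×↔Fin (×↔Fin ↔-refl ↔-refl) (Vertex↔Fin 0 n))
  (Fin-cong (trans (*-identityˡ _) (*-identityˡ _))))
Mλ-size (suc m) n _ lam = ↔-trans (Mλ-suc↔ m n lam) (↔-trans (×↔Fin (×↔Fin ↔-refl ↔-refl) (Vertex↔Fin m n))
  (Fin-cong (4*[16^m*4^n]≡4^[2[1+m]+n∸1] m n)))

lemma2 : (m n : ℕ) → 1 ≤ m + n → (lam : Vec Z4 m → Vec (Fin 2) n → Fin 2) → IsMDS m n (Mλ m n lam)
lemma2 m n 1≤m+n lam = Mλ-independent m n lam , Mλ-size m n 1≤m+n lam
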